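{- Let $p$ be a prime. (1) For natural numbers $m,n$: [$m=p^r$ and $n=p^s$ for some integers $r,s\geq1$, and $n-m=p^{\ell}(m-1)$ for some $\ell\in\mathbb{Z}$] holds if and only if [$m=p^h$ and $n=m^2$ for some integer $h\geq1$]. (2) For integers $m,n$: [$m,n\in\{\pm p^h\colon h\geq1\}$ and $n-m=\pm p^{\ell}(m-1)$ for some $\ell\in\mathbb{Z}$] holds if and only if $m,n\in\{\pm p^h\colon h\geq1\}$ and either $n=m^2$, or $p=2$ and $(m,n)\in\{(-2,-8),(2,-2),(4,-2),(4,-8)\}$, or $p=3$ and $(m,n)=(3,-3)$.
   Context: In the paper these conditions are expressed as the positive existential formulas $R(1,m)\wedge m\geq2\wedge R(1,n)\wedge n\geq2\wedge R(m-1,n-m)$ in $(\mathbb{N};0,1,+,\mid_p)$ and $R(1,m)\wedge T(m)\wedge R(1,n)\wedge T(n)\wedge R(m-1,n-m)$ in $(\mathbb{Z};0,1,+,\mid,\mid_p,\mathbb{Z}\smallsetminus\{ -1,0,1\})$, where $x\mid_p y$ means $y=\pm xp^s$ for some $s\in\mathbb{Z}$ and $T$ is the set $\mathbb{Z}\smallsetminus\{ -1,0,1\}$. -}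

module Defs where

open import Data.Nat using (ℕ; suc; _^_; _≥_)
open import Data.Integer using (ℤ; +_; -[1+_]; _*_; -_)
open import Data.Product using (∃; _×_)
open import Data.Sum using (_⊎_)
open import Relation.Binary.PropositionalEquality using (_≡_)

-- ScaledBy p ℓ x y  means  x = p^ℓ · y  (ℓ ∈ ℤ, possibly negative), read in ℚ.
-- For ℓ = k ≥ 0 this is x = p^k y; for ℓ = -(k+1) < 0 it is
-- x = y / p^(k+1), i.e. p^(k+1) x = y (denominators cleared).
ScaledBy : ℕ → ℤ → ℤ → ℤ → Set
ScaledBy p (+ k)     x y = x ≡ (+ (p ^ k)) * y
ScaledBy p -[1+ k ]  x y = (+ (p ^ suc k)) * x ≡ y

PlusMinusPow : ℕ → ℤ → Set
PlusMinusPow p x = ∃ λ h → h ≥ 1 × (x ≡ + (p ^ h) ⊎ x ≡ - (+ (p ^ h)))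

module Submission where

open import Defs
open import Data.Nat using (ℕ; _^_; _≥_)
open import Data.Nat.Primality using (Prime)
open import Data.Integer using (ℤ; +_; _-_; _*_; -_)
open import Data.Product using (∃; _×_)
open import Data.Sum using (_⊎_)
open import Function.Bundles using (_⇔_)
open import Relation.Binary.PropositionalEquality using (_≡_)

open import Data.Nat as ℕ using (zero; suc; _≤_; _<_; s≤s; z≤n; compare; less; equal; greater)
import Data.Nat.Properties as ℕP
import Data.Nat.Divisibility as ℕD
open import Data.Nat.Primality using (prime?; prime[2]; prime⇒nonTrivial; prime⇒irreducible; irreducible[2])
open import Data.Integer as ℤ using (-[1+_]; _+_; 0ℤ; 1ℤ; -1ℤ; +≤+)
import Data.Integer.Properties as ℤP
import Data.Integer.Divisibility.Signed as ℤD
open import Data.Integer.Tactic.RingSolver using (solve-∀; solve)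
open import Data.List using (_∷_; [])
open import Data.Product using (_,_)
open import Data.Sum using (inj₁; inj₂)
open import Data.Empty using (⊥-elim)
open import Relation.Nullary using (¬_)
open import Relation.Nullary.Decidable using (from-yes)
open import Relation.Binary.PropositionalEquality
  using (_≢_; refl; sym; trans; cong; subst; module ≡-Reasoning)
open import Relation.Binary using (tri<; tri≈; tri>)
open import Function.Bundles using (mk⇔)

-- Write m = ε p^(a+1) and n = δ p^(b+1) with signs ε, δ = ±1, and suppose
-- n − m = σ p^ℓ (m − 1) with σ = ±1.  Since p divides m, it does not divide
-- m − 1, so ℓ < 0 is impossible and for ℓ = k ≥ 0 the right-hand side is
-- p^k times a number prime to p.  Comparing a with b:
--   a < b :  n − m = p^(a+1) (δ p^(b−a) − ε), cofactor prime to p;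
--   a > b :  n − m = p^(b+1) (δ − ε p^(a−b)), cofactor prime to p;
--   a = b :  n − m = (δ − ε) p^(a+1).
-- In the first two cases uniqueness of the p-free part turns the equation into
-- a linear relation ±x ± y ∈ {0, ±2} between two powers x, y ≥ 2 of p; in the
-- third it becomes p^e (y ∓ 1) = ±2.  Each sign pattern is then settled by
-- elementary facts about powers of p: x + y ≥ 4, p^(i+1) = p^(j+1) + 2 only as
-- 4 = 2 + 2, and E·y = E + 2 forces y ∈ {2, 3}.  The converse is a direct check.
-- The argument only uses p > 1; primality of p enters the final theorem only
-- through this inequality.  Part (1) is the case m, n > 0 of part (2).

rearrange : ∀ {a b c d : ℤ} → a ≡ b → c - d ≡ a - b → c ≡ d
rearrange {c = c} {d} a≡b c-d≡a-b = ℤP.i-j≡0⇒i≡j c d (trans c-d≡a-b (ℤP.i≡j⇒i-j≡0 a≡b))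

data Sgn : ℤ → Set where
  pos : Sgn 1ℤ
  neg : Sgn -1ℤ

sgn-neg : ∀ {ε} → Sgn ε → Sgn (- ε)
sgn-neg pos = neg
sgn-neg neg = pos

sgn-involutive : ∀ {σ} → Sgn σ → ∀ u → σ * (σ * u) ≡ u
sgn-involutive pos = solve-∀
sgn-involutive neg = solve-∀

factor-less : ∀ d e y x → d * (y * x) - e * y ≡ y * (d * x - e)
factor-less = solve-∀

factor-greater : ∀ d e z x → d * z - e * (z * x) ≡ z * (d - e * x)
factor-greater = solve-∀

opposite-difference : ∀ e y → (- e) * y - e * y ≡ y * (- e - e)
opposite-difference = solve-∀

square-minus : ∀ x → x * x - x ≡ x * (x - 1ℤ)
square-minus = solve-∀

square-minus′ : ∀ x → x * x - x ≡ (- x) * (- (x - 1ℤ))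
square-minus′ = solve-∀

-- If E·Y = E + 2 then E·(Y − 1) = 2, so Y − 1 divides 2 and Y ∈ {2, 3}.
mul≡add2 : ∀ E Y → E ℕ.* Y ≡ E ℕ.+ 2 → Y ≡ 2 ⊎ Y ≡ 3
mul≡add2 E zero e with ℕP.m+n≡0⇒n≡0 E (sym (trans (sym (ℕP.*-zeroʳ E)) e))
... | ()
mul≡add2 E (suc Z) e
  with irreducible[2] (ℕD.divides E (sym (ℕP.+-cancelˡ-≡ E _ _ (trans (sym (ℕP.*-suc E Z)) e))))
... | inj₁ refl = inj₁ refl
... | inj₂ refl = inj₂ refl

prime[3] : Prime 3
prime[3] = from-yes (prime? 3)

Exceptional : ℕ → ℤ → ℤ → Set
Exceptional p m n =
  (p ≡ 2 × ((m ≡ - (+ 2) × n ≡ - (+ 8)) ⊎ (m ≡ + 2 × n ≡ - (+ 2))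
            ⊎ (m ≡ + 4 × n ≡ - (+ 2)) ⊎ (m ≡ + 4 × n ≡ - (+ 8))))
  ⊎ (p ≡ 3 × m ≡ + 3 × n ≡ - (+ 3))

Solution : ℕ → ℤ → ℤ → Set
Solution p m n = n ≡ m * m ⊎ Exceptional p m n

solution[-2,-8] : Solution 2 (- (+ 2)) (- (+ 8))
solution[-2,-8] = inj₂ (inj₁ (refl , inj₁ (refl , refl)))

solution[2,-2] : Solution 2 (+ 2) (- (+ 2))
solution[2,-2] = inj₂ (inj₁ (refl , inj₂ (inj₁ (refl , refl))))

solution[4,-2] : Solution 2 (+ 4) (- (+ 2))
solution[4,-2] = inj₂ (inj₁ (refl , inj₂ (inj₂ (inj₁ (refl , refl)))))

solution[4,-8] : Solution 2 (+ 4) (- (+ 8))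
solution[4,-8] = inj₂ (inj₁ (refl , inj₂ (inj₂ (inj₂ (refl , refl)))))

solution[3,-3] : Solution 3 (+ 3) (- (+ 3))
solution[3,-3] = inj₂ (inj₂ (refl , refl , refl))

ScaledUpToSign : ℕ → ℤ → ℤ → Set
ScaledUpToSign p m n =
  ∃ λ ℓ → ScaledBy p ℓ (n - m) (m - + 1) ⊎ ScaledBy p ℓ (n - m) (- (m - + 1))

data SignedPower (p : ℕ) : ℤ → Set where
  signed : ∀ {ε} → Sgn ε → ∀ a → SignedPower p (ε * + (p ^ suc a))

signed-power : ∀ {p x} → PlusMinusPow p x → SignedPower p x
signed-power (zero , () , _)
signed-power {p} (suc a , _ , inj₁ refl) = subst (SignedPower p) (ℤP.*-identityˡ _) (signed pos a)
signed-power {p} (suc a , _ , inj₂ refl) = subst (SignedPower p) (ℤP.-1*i≡-i _) (signed neg a)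

square-scaled : ∀ {p m} → PlusMinusPow p m → ScaledUpToSign p m (m * m)
square-scaled {m = m} (h , _ , inj₁ m≡) =
  + h , inj₁ (trans (square-minus m) (cong (_* (m - 1ℤ)) m≡))
square-scaled {m = m} (h , _ , inj₂ m≡) =
  + h , inj₂ (trans (square-minus′ m) (cong (_* (- (m - 1ℤ))) (trans (cong -_ m≡) (ℤP.neg-involutive _))))

exceptional-scaled : ∀ {p m n} → Exceptional p m n → ScaledUpToSign p m n
exceptional-scaled (inj₁ (refl , inj₁ (refl , refl))) = + 1 , inj₁ refl
exceptional-scaled (inj₁ (refl , inj₂ (inj₁ (refl , refl)))) = + 2 , inj₂ refl
exceptional-scaled (inj₁ (refl , inj₂ (inj₂ (inj₁ (refl , refl))))) = + 1 , inj₂ refl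
exceptional-scaled (inj₁ (refl , inj₂ (inj₂ (inj₂ (refl , refl))))) = + 2 , inj₂ refl
exceptional-scaled (inj₂ (refl , refl , refl)) = + 1 , inj₂ refl

-- Among solutions with m, n > 0 only squares remain: all exceptional n are negative.
natural-square : ∀ {p m n} → Solution p (+ m) (+ n) → n ≡ m ℕ.* m
natural-square {m = m} (inj₁ n≡m²) = ℤP.+-injective (trans n≡m² (sym (ℤP.pos-* m m)))
natural-square (inj₂ (inj₁ (_ , inj₁ (_ , ()))))
natural-square (inj₂ (inj₁ (_ , inj₂ (inj₁ (_ , ())))))
natural-square (inj₂ (inj₁ (_ , inj₂ (inj₂ (inj₁ (_ , ()))))))
natural-square (inj₂ (inj₁ (_ , inj₂ (inj₂ (inj₂ (_ , ()))))))
natural-square (inj₂ (inj₂ (_ , _ , ())))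

module _ (p : ℕ) (1<p : 1 < p) where

  instance
    p≢0 : ℕ.NonZero p
    p≢0 = ℕ.>-nonZero (ℕP.<-trans (s≤s z≤n) 1<p)

  p≢1 : p ≢ 1
  p≢1 = ℕP.>⇒≢ 1<p

  pow≥2 : ∀ x → 2 ≤ p ^ suc x
  pow≥2 x = ℕP.≤-trans 1<p (ℕP.m≤m*n p (p ^ x) {{ℕP.m^n≢0 p x}})

  p∣pow : ∀ x → p ℕD.∣ p ^ suc x
  p∣pow x = ℕD.divides (p ^ x) (ℕP.*-comm p (p ^ x))

  pow-injective : ∀ {x y} → p ^ x ≡ p ^ y → x ≡ y
  pow-injective {x} {y} e with ℕP.<-cmp x y
  ... | tri< x<y _ _ = ⊥-elim (ℕP.<⇒≢ (ℕP.^-monoʳ-< p 1<p x<y) e)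
  ... | tri≈ _ x≡y _ = x≡y
  ... | tri> _ _ y<x = ⊥-elim (ℕP.>⇒≢ (ℕP.^-monoʳ-< p 1<p y<x) e)

  pow≡prime : ∀ {q} x → Prime q → p ^ suc x ≡ q → p ≡ q × x ≡ 0
  pow≡prime x q-prime e with prime⇒irreducible q-prime (subst (p ℕD.∣_) e (p∣pow x))
  ... | inj₁ p≡1 = ⊥-elim (p≢1 p≡1)
  ... | inj₂ p≡q =
    p≡q , ℕP.suc-injective (pow-injective (trans e (trans (sym p≡q) (sym (ℕP.*-identityʳ p)))))

  -- p^x = p^y + 1 forces y = 0: otherwise p divides both p^y and p^y + 1.
  pow≡pow+1 : ∀ x y → p ^ x ≡ p ^ y ℕ.+ 1 → y ≡ 0
  pow≡pow+1 _ zero _ = refl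
  pow≡pow+1 zero (suc y) e = ⊥-elim (ℕP.<⇒≢ (ℕP.+-monoˡ-< 1 (ℕP.m^n>0 p (suc y))) e)
  pow≡pow+1 (suc x) (suc y) e =
    ⊥-elim (p≢1 (ℕD.∣1⇒≡1 (ℕD.∣m+n∣m⇒∣n (subst (p ℕD.∣_) e (p∣pow x)) (p∣pow y))))

  pow≡pow+2 : ∀ x y → p ^ suc x ≡ p ^ suc y ℕ.+ 2 → p ≡ 2 × x ≡ 1 × y ≡ 0
  pow≡pow+2 x y e = p≡2 , x≡1 , y≡0
    where
    open ≡-Reasoning
    p≡2 : p ≡ 2
    p≡2 = ℕP.≤-antisym (ℕD.∣⇒≤ (ℕD.∣m+n∣m⇒∣n (subst (p ℕD.∣_) e (p∣pow x)) (p∣pow y))) 1<p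
    halved : p ^ x ≡ p ^ y ℕ.+ 1
    halved = ℕP.*-cancelˡ-≡ (p ^ x) (p ^ y ℕ.+ 1) p (begin
      p ℕ.* p ^ x                   ≡⟨ e ⟩
      p ℕ.* p ^ y ℕ.+ 2             ≡⟨ cong (p ℕ.* p ^ y ℕ.+_) (sym (trans (ℕP.*-identityʳ p) p≡2)) ⟩
      p ℕ.* p ^ y ℕ.+ p ℕ.* 1       ≡⟨ sym (ℕP.*-distribˡ-+ p (p ^ y) 1) ⟩
      p ℕ.* (p ^ y ℕ.+ 1)           ∎)
    y≡0 : y ≡ 0
    y≡0 = pow≡pow+1 x y halved
    x≡1 : x ≡ 1
    x≡1 = pow-injective (trans (subst (λ z → p ^ x ≡ p ^ z ℕ.+ 1) y≡0 halved)
                               (trans (sym p≡2) (sym (ℕP.*-identityʳ p))))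

  pow-split : ∀ i j → + (p ^ suc (suc (i ℕ.+ j))) ≡ + (p ^ suc i) * + (p ^ suc j)
  pow-split i j = trans (cong (λ e → + (p ^ suc e)) (sym (ℕP.+-suc i j)))
                        (trans (cong +_ (ℕP.^-distribˡ-+-* p (suc i) (suc j)))
                               (ℤP.pos-* (p ^ suc i) (p ^ suc j)))

  Indivisible : ℤ → Set
  Indivisible u = ¬ (+ p ℤD.∣ u)

  p∣ᶻpow : ∀ x → + p ℤD.∣ + (p ^ suc x)
  p∣ᶻpow x = ℤD.∣ᵤ⇒∣ (p∣pow x)

  pow-suc* : ∀ k u → + (p ^ suc k) * u ≡ + p * (+ (p ^ k) * u)
  pow-suc* k u = trans (cong (_* u) (ℤP.pos-* p (p ^ k))) (ℤP.*-assoc (+ p) (+ (p ^ k)) u)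

  p∣pow* : ∀ k u → + p ℤD.∣ + (p ^ suc k) * u
  p∣pow* k u = subst (+ p ℤD.∣_) (sym (pow-suc* k u)) (ℤD.∣m⇒∣m*n (+ (p ^ k) * u) ℤD.∣-refl)

  indivisible-sgn : ∀ {ε} → Sgn ε → Indivisible ε
  indivisible-sgn pos p∣1 = p≢1 (ℕD.∣1⇒≡1 (ℤD.∣⇒∣ᵤ p∣1))
  indivisible-sgn neg p∣1 = p≢1 (ℕD.∣1⇒≡1 (ℤD.∣⇒∣ᵤ p∣1))

  indivisible-shift : ∀ {ε a} → Sgn ε → + p ℤD.∣ a → Indivisible (a + ε)
  indivisible-shift sε p∣a p∣a+ε = indivisible-sgn sε (ℤD.∣m+n∣m⇒∣n p∣a+ε p∣a)

  indivisible-sgn* : ∀ {σ u} → Sgn σ → Indivisible u → Indivisible (σ * u)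
  indivisible-sgn* {σ} {u} sσ u∤ p∣σu = u∤ (subst (+ p ℤD.∣_) (sgn-involutive sσ u) (ℤD.∣n⇒∣m*n σ p∣σu))

  indivisible-pred : ∀ {ε σ} → Sgn ε → Sgn σ → ∀ a → Indivisible (σ * (ε * + (p ^ suc a) - 1ℤ))
  indivisible-pred {ε} sε sσ a = indivisible-sgn* sσ (indivisible-shift neg (ℤD.∣n⇒∣m*n ε (p∣ᶻpow a)))

  strip-powers : ∀ k j {u v} → Indivisible u → + (p ^ k) * u ≡ + (p ^ j) * v → ∃ λ e → + (p ^ e) * u ≡ v
  strip-powers k zero {v = v} _ eq = k , trans eq (ℤP.*-identityˡ v)
  strip-powers zero (suc j) {u} {v} u∤ eq =
    ⊥-elim (u∤ (subst (+ p ℤD.∣_) (trans (sym eq) (ℤP.*-identityˡ u)) (p∣pow* j v)))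
  strip-powers (suc k) (suc j) {u} {v} u∤ eq = strip-powers k j u∤ (ℤP.*-cancelˡ-≡ (+ p) _ _ (begin
    + p * (+ (p ^ k) * u)   ≡⟨ sym (pow-suc* k u) ⟩
    + (p ^ suc k) * u       ≡⟨ eq ⟩
    + (p ^ suc j) * v       ≡⟨ pow-suc* j v ⟩
    + p * (+ (p ^ j) * v)   ∎))
    where open ≡-Reasoning

  p-free-parts-agree : ∀ k j {u v} → Indivisible u → Indivisible v → + (p ^ k) * u ≡ + (p ^ j) * v → u ≡ v
  p-free-parts-agree k j {u} u∤ v∤ eq with strip-powers k j u∤ eq
  ... | zero , 1u≡v = trans (sym (ℤP.*-identityˡ u)) 1u≡v
  ... | suc e , pu≡v = ⊥-elim (v∤ (subst (+ p ℤD.∣_) pu≡v (p∣pow* e u)))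

  sum-of-powers : ∀ c a {x y} → x ≡ + (p ^ suc c) → y ≡ + (p ^ suc a) → ∀ t → x + y ≡ t → + 4 ℤ.≤ t
  sum-of-powers c a refl refl _ refl = +≤+ (ℕP.+-mono-≤ (pow≥2 c) (pow≥2 a))

  equal-powers : ∀ c a {x y} → x ≡ + (p ^ suc c) → y ≡ + (p ^ suc a) → x ≡ y → c ≡ a
  equal-powers c a refl refl x≡y = ℕP.suc-injective (pow-injective (ℤP.+-injective x≡y))

  powers-two-apart : ∀ c a {x y} → x ≡ + (p ^ suc c) → y ≡ + (p ^ suc a) → x ≡ y + + 2 →
                     p ≡ 2 × c ≡ 1 × a ≡ 0
  powers-two-apart c a refl refl x≡y+2 = pow≡pow+2 c a (ℤP.+-injective x≡y+2)

  product-large : ∀ e a {x y} → x ≡ + (p ^ e) → y ≡ + (p ^ suc a) → ∀ t → x * y + x ≡ t → + 3 ℤ.≤ t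
  product-large e a refl refl _ refl =
    subst (+ 3 ℤ.≤_) (cong (_+ + (p ^ e)) (ℤP.pos-* (p ^ e) (p ^ suc a)))
      (+≤+ (ℕP.+-mono-≤ (ℕP.*-mono-≤ (ℕP.m^n>0 p e) (pow≥2 a)) (ℕP.m^n>0 p e)))

  product-exceeds : ∀ e a {x y} → x ≡ + (p ^ e) → y ≡ + (p ^ suc a) → ¬ (x * y + + 2 ≡ x)
  product-exceeds e a refl refl eq =
    ℕP.<⇒≢ (ℕP.≤-<-trans (ℕP.m≤m*n E Y {{ℕP.m^n≢0 p (suc a)}}) (ℕP.m<m+n (E ℕ.* Y) {2} (s≤s z≤n)))
      (sym (ℤP.+-injective (trans (cong (_+ + 2) (ℤP.pos-* E Y)) eq)))
    where
    E Y : ℕ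
    E = p ^ e
    Y = p ^ suc a

  product-two-more : ∀ e a {x y} → x ≡ + (p ^ e) → y ≡ + (p ^ suc a) → x * y ≡ x + + 2 →
                     (p ≡ 2 × a ≡ 0) ⊎ (p ≡ 3 × a ≡ 0)
  product-two-more e a refl refl eq
    with mul≡add2 (p ^ e) (p ^ suc a) (ℤP.+-injective (trans (ℤP.pos-* (p ^ e) (p ^ suc a)) eq))
  ... | inj₁ y≡2 = inj₁ (pow≡prime a prime[2] y≡2)
  ... | inj₂ y≡3 = inj₂ (pow≡prime a prime[3] y≡3)

  square : ∀ {ε} → Sgn ε → ∀ x y → x ≡ y → Solution p (ε * y) (1ℤ * (y * x))
  square pos x .x refl = inj₁ (solve (x ∷ []))
  square neg x .x refl = inj₁ (solve (x ∷ []))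

  -- Case a < b after cancelling p^(a+1):  δ x − ε = σ(ε y − 1), x = p^(c+1), y = p^(a+1).
  less-leaf : ∀ {ε δ σ} → Sgn ε → Sgn δ → Sgn σ → ∀ c a x y → x ≡ + (p ^ suc c) → y ≡ + (p ^ suc a) →
              δ * x - ε ≡ σ * (ε * y - 1ℤ) → Solution p (ε * y) (δ * (y * x))
  less-leaf pos pos pos c a x y _ _ eq = square pos x y (rearrange eq (solve (x ∷ y ∷ [])))
  less-leaf pos pos neg c a x y hx hy eq with sum-of-powers c a hx hy (+ 2) (rearrange eq (solve (x ∷ y ∷ [])))
  ... | +≤+ (s≤s (s≤s ()))
  less-leaf pos neg pos c a x y hx hy eq
    with sum-of-powers c a hx hy 0ℤ (sym (rearrange eq (solve (x ∷ y ∷ []))))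
  ... | +≤+ ()
  -- −x − 1 = 1 − y, so y = x + 2: (m, n) = (4, −8)
  less-leaf pos neg neg c a x y hx hy eq with powers-two-apart a c hy hx (rearrange eq (solve (x ∷ y ∷ [])))
  less-leaf pos neg neg c a x y refl refl eq | refl , refl , refl = solution[4,-8]
  less-leaf neg pos pos c a x y hx hy eq
    with sum-of-powers c a hx hy (- (+ 2)) (rearrange eq (solve (x ∷ y ∷ [])))
  ... | ()
  less-leaf neg pos neg c a x y _ _ eq = square neg x y (rearrange eq (solve (x ∷ y ∷ [])))
  -- −x + 1 = −y − 1, so x = y + 2: (m, n) = (−2, −8)
  less-leaf neg neg pos c a x y hx hy eq
    with powers-two-apart c a hx hy (sym (rearrange eq (solve (x ∷ y ∷ []))))
  less-leaf neg neg pos c a x y refl refl eq | refl , refl , refl = solution[-2,-8]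
  less-leaf neg neg neg c a x y hx hy eq
    with sum-of-powers c a hx hy 0ℤ (sym (rearrange eq (solve (x ∷ y ∷ []))))
  ... | +≤+ ()

  -- Case a > b after cancelling p^(b+1):  δ − ε x = σ(ε y − 1), x = p^(c+1), y = p^(b+c+2).
  greater-leaf : ∀ {ε δ σ} → Sgn ε → Sgn δ → Sgn σ → ∀ b c x y →
                 x ≡ + (p ^ suc c) → y ≡ + (p ^ suc (suc (b ℕ.+ c))) →
                 δ - ε * x ≡ σ * (ε * y - 1ℤ) → Solution p (ε * y) (δ * + (p ^ suc b))
  greater-leaf pos pos pos b c x y hx hy eq
    with sum-of-powers c (suc (b ℕ.+ c)) hx hy (+ 2) (sym (rearrange eq (solve (x ∷ y ∷ []))))
  ... | +≤+ (s≤s (s≤s ()))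
  greater-leaf pos pos neg b c x y hx hy eq =
    ⊥-elim (ℕP.m≢1+n+m c (equal-powers c (suc (b ℕ.+ c)) hx hy (sym (rearrange eq (solve (x ∷ y ∷ []))))))
  greater-leaf pos neg pos b c x y hx hy eq
    with sum-of-powers c (suc (b ℕ.+ c)) hx hy 0ℤ (sym (rearrange eq (solve (x ∷ y ∷ []))))
  ... | +≤+ ()
  -- −1 − x = 1 − y, so y = x + 2: (m, n) = (4, −2)
  greater-leaf pos neg neg b c x y hx hy eq
    with powers-two-apart (suc (b ℕ.+ c)) c hy hx (rearrange eq (solve (x ∷ y ∷ [])))
  ... | refl , a≡1 , refl with ℕP.m+n≡0⇒m≡0 b (ℕP.suc-injective a≡1)
  greater-leaf pos neg neg b c x y refl refl eq | refl , _ , refl | refl = solution[4,-2]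
  greater-leaf neg pos pos b c x y hx hy eq
    with sum-of-powers c (suc (b ℕ.+ c)) hx hy (- (+ 2)) (rearrange eq (solve (x ∷ y ∷ [])))
  ... | ()
  greater-leaf neg pos neg b c x y hx hy eq =
    ⊥-elim (ℕP.m≢1+n+m c (equal-powers c (suc (b ℕ.+ c)) hx hy (rearrange eq (solve (x ∷ y ∷ [])))))
  greater-leaf neg neg pos b c x y hx hy eq
    with sum-of-powers c (suc (b ℕ.+ c)) hx hy 0ℤ (rearrange eq (solve (x ∷ y ∷ [])))
  ... | +≤+ ()
  -- −1 + x = y + 1, so x = y + 2, impossible as y = p^(b+c+2) ≥ 4
  greater-leaf neg neg neg b c x y hx hy eq
    with powers-two-apart c (suc (b ℕ.+ c)) hx hy (rearrange eq (solve (x ∷ y ∷ [])))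
  ... | _ , _ , ()

  -- Case a = b, m = y, n = −y, after cancelling p^(a+1):  x·σ(y − 1) = −2 with x = p^e.
  opposite-leaf₊ : ∀ {σ} → Sgn σ → ∀ e a x y → x ≡ + (p ^ e) → y ≡ + (p ^ suc a) →
                   x * (σ * (1ℤ * y - 1ℤ)) ≡ - (+ 2) → Solution p (1ℤ * y) (-1ℤ * y)
  opposite-leaf₊ pos e a x y hx hy eq = ⊥-elim (product-exceeds e a hx hy (rearrange eq (solve (x ∷ y ∷ []))))
  opposite-leaf₊ neg e a x y hx hy eq with product-two-more e a hx hy (sym (rearrange eq (solve (x ∷ y ∷ []))))
  opposite-leaf₊ neg e a x y hx refl eq | inj₁ (refl , refl) = solution[2,-2]
  opposite-leaf₊ neg e a x y hx refl eq | inj₂ (refl , refl) = solution[3,-3]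

  opposite-leaf₋ : ∀ {σ} → Sgn σ → ∀ e a x y → x ≡ + (p ^ e) → y ≡ + (p ^ suc a) →
                   ¬ (x * (σ * (-1ℤ * y - 1ℤ)) ≡ + 2)
  opposite-leaf₋ pos e a x y hx hy eq
    with product-large e a hx hy (- (+ 2)) (sym (rearrange eq (solve (x ∷ y ∷ []))))
  ... | ()
  opposite-leaf₋ neg e a x y hx hy eq with product-large e a hx hy (+ 2) (rearrange eq (solve (x ∷ y ∷ [])))
  ... | +≤+ (s≤s (s≤s ()))

  -- n = m contradicts the hypothesis: 0 = p^k σ(m − 1) with m − 1 ≠ 0.
  no-equal-signs : ∀ {ε σ} → Sgn ε → Sgn σ → ∀ a k →
                   ¬ (ε * + (p ^ suc a) - ε * + (p ^ suc a) ≡ + (p ^ k) * (σ * (ε * + (p ^ suc a) - 1ℤ)))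
  no-equal-signs {ε} {σ} sε sσ a k eq =
    indivisible-pred sε sσ a (subst (+ p ℤD.∣_) (sym w≡0) (ℤD.divides 0ℤ refl))
    where
    w≡0 : σ * (ε * + (p ^ suc a) - 1ℤ) ≡ 0ℤ
    w≡0 = ℤP.*-cancelˡ-≡ (+ (p ^ k)) _ 0ℤ {{ℕP.m^n≢0 p k}}
            (trans (sym eq) (trans (ℤP.+-inverseʳ (ε * + (p ^ suc a))) (sym (ℤP.*-zeroʳ (+ (p ^ k))))))

  strip-opposite : ∀ {ε σ} → Sgn ε → Sgn σ → ∀ a k →
                   (- ε) * + (p ^ suc a) - ε * + (p ^ suc a) ≡ + (p ^ k) * (σ * (ε * + (p ^ suc a) - 1ℤ)) →
                   ∃ λ e → + (p ^ e) * (σ * (ε * + (p ^ suc a) - 1ℤ)) ≡ - ε - ε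
  strip-opposite {ε} sε sσ a k eq =
    strip-powers k (suc a) (indivisible-pred sε sσ a) (trans (sym eq) (opposite-difference ε (+ (p ^ suc a))))

  -- Case a < b, i.e. b = a + c + 1: then n − m = p^(a+1)(δ p^(c+1) − ε).
  less-case : ∀ {ε δ σ} → Sgn ε → Sgn δ → Sgn σ → ∀ a c k →
              δ * + (p ^ suc (suc (a ℕ.+ c))) - ε * + (p ^ suc a) ≡ + (p ^ k) * (σ * (ε * + (p ^ suc a) - 1ℤ)) →
              Solution p (ε * + (p ^ suc a)) (δ * + (p ^ suc (suc (a ℕ.+ c))))
  less-case {ε} {δ} {σ} sε sδ sσ a c k eq =
    subst (λ z → Solution p (ε * y) (δ * z)) (sym (pow-split a c))
      (less-leaf sε sδ sσ c a x y refl refl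
        (p-free-parts-agree (suc a) k cofactor∤ (indivisible-pred sε sσ a) factored))
    where
    x y : ℤ
    x = + (p ^ suc c)
    y = + (p ^ suc a)
    cofactor∤ : Indivisible (δ * x - ε)
    cofactor∤ = indivisible-shift (sgn-neg sε) (ℤD.∣n⇒∣m*n δ (p∣ᶻpow c))
    factored : y * (δ * x - ε) ≡ + (p ^ k) * (σ * (ε * y - 1ℤ))
    factored = trans (sym (factor-less δ ε y x))
                     (trans (cong (λ z → δ * z - ε * y) (sym (pow-split a c))) eq)

  -- Case a > b, i.e. a = b + c + 1: then n − m = p^(b+1)(δ − ε p^(c+1)).
  greater-case : ∀ {ε δ σ} → Sgn ε → Sgn δ → Sgn σ → ∀ b c k →
                 δ * + (p ^ suc b) - ε * + (p ^ suc (suc (b ℕ.+ c)))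
                   ≡ + (p ^ k) * (σ * (ε * + (p ^ suc (suc (b ℕ.+ c))) - 1ℤ)) →
                 Solution p (ε * + (p ^ suc (suc (b ℕ.+ c)))) (δ * + (p ^ suc b))
  greater-case {ε} {δ} {σ} sε sδ sσ b c k eq =
    greater-leaf sε sδ sσ b c x y refl refl
      (p-free-parts-agree (suc b) k cofactor∤ (indivisible-pred sε sσ (suc (b ℕ.+ c))) factored)
    where
    x y z : ℤ
    x = + (p ^ suc c)
    y = + (p ^ suc (suc (b ℕ.+ c)))
    z = + (p ^ suc b)
    cofactor∤ : Indivisible (δ - ε * x)
    cofactor∤ = subst Indivisible (ℤP.+-comm (- (ε * x)) δ)
                  (indivisible-shift sδ (ℤD.∣m⇒∣-m (ℤD.∣n⇒∣m*n ε (p∣ᶻpow c))))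
    factored : z * (δ - ε * x) ≡ + (p ^ k) * (σ * (ε * y - 1ℤ))
    factored = trans (sym (factor-greater δ ε z x))
                     (trans (cong (λ w → δ * z - ε * w) (sym (pow-split b c))) eq)

  equal-case : ∀ {ε δ σ} → Sgn ε → Sgn δ → Sgn σ → ∀ a k →
               δ * + (p ^ suc a) - ε * + (p ^ suc a) ≡ + (p ^ k) * (σ * (ε * + (p ^ suc a) - 1ℤ)) →
               Solution p (ε * + (p ^ suc a)) (δ * + (p ^ suc a))
  equal-case pos pos sσ a k eq = ⊥-elim (no-equal-signs pos sσ a k eq)
  equal-case neg neg sσ a k eq = ⊥-elim (no-equal-signs neg sσ a k eq)
  equal-case pos neg sσ a k eq with strip-opposite pos sσ a k eq
  ... | e , stripped = opposite-leaf₊ sσ e a _ _ refl refl stripped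
  equal-case neg pos sσ a k eq with strip-opposite neg sσ a k eq
  ... | e , stripped = ⊥-elim (opposite-leaf₋ sσ e a _ _ refl refl stripped)

  classify : ∀ {ε δ σ} → Sgn ε → Sgn δ → Sgn σ → ∀ a b ℓ →
             ScaledBy p ℓ (δ * + (p ^ suc b) - ε * + (p ^ suc a)) (σ * (ε * + (p ^ suc a) - 1ℤ)) →
             Solution p (ε * + (p ^ suc a)) (δ * + (p ^ suc b))
  classify sε sδ sσ a b -[1+ k ] eq = ⊥-elim (indivisible-pred sε sσ a (subst (+ p ℤD.∣_) eq (p∣pow* k _)))
  classify sε sδ sσ a b (+ k) eq with compare a b
  ... | less _ c = less-case sε sδ sσ a c k eq
  ... | equal _ = equal-case sε sδ sσ a k eq
  ... | greater _ c = greater-case sε sδ sσ b c k eq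

  solutions-only : ∀ {m n} → PlusMinusPow p m → PlusMinusPow p n → ScaledUpToSign p m n → Solution p m n
  solutions-only pm pn (ℓ , scaled) with signed-power pm | signed-power pn | scaled
  ... | signed sε a | signed sδ b | inj₁ s =
    classify sε sδ pos a b ℓ (subst (ScaledBy p ℓ _) (sym (ℤP.*-identityˡ _)) s)
  ... | signed sε a | signed sδ b | inj₂ s =
    classify sε sδ neg a b ℓ (subst (ScaledBy p ℓ _) (sym (ℤP.-1*i≡-i _)) s)

  part2 : ∀ m n → (PlusMinusPow p m × PlusMinusPow p n × ScaledUpToSign p m n)
                  ⇔ (PlusMinusPow p m × PlusMinusPow p n × Solution p m n)
  part2 m n = mk⇔
    (λ (pm , pn , scaled) → pm , pn , solutions-only pm pn scaled)
    (λ { (pm , pn , inj₁ refl) → pm , pn , square-scaled pm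
       ; (pm , pn , inj₂ ex) → pm , pn , exceptional-scaled ex })

  PowerOf : ℕ → Set
  PowerOf m = ∃ λ r → r ≥ 1 × m ≡ p ^ r

  part1 : ∀ m n → (PowerOf m × PowerOf n × ∃ λ ℓ → ScaledBy p ℓ (+ n - + m) (+ m - + 1))
                  ⇔ (∃ λ h → h ≥ 1 × m ≡ p ^ h × n ≡ m ℕ.* m)
  part1 m n = mk⇔
    (λ ((r , r≥1 , m≡) , (s , s≥1 , n≡) , ℓ , scaled) →
      r , r≥1 , m≡ , natural-square (solutions-only (r , r≥1 , inj₁ (cong +_ m≡))
                                                   (s , s≥1 , inj₁ (cong +_ n≡)) (ℓ , inj₁ scaled)))
    (λ { (h , h≥1 , refl , refl) →
      (h , h≥1 , refl)
      , (h ℕ.+ h , ℕP.≤-trans h≥1 (ℕP.m≤m+n h h) , sym (ℕP.^-distribˡ-+-* p h h))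
      , + h , trans (cong (_- + (p ^ h)) (ℤP.pos-* (p ^ h) (p ^ h))) (square-minus (+ (p ^ h))) })

lemma4p4 : (p : ℕ) → Prime p →
    ((m n : ℕ) →
      ((∃ λ r → r ≥ 1 × m ≡ p ^ r) × (∃ λ s → s ≥ 1 × n ≡ p ^ s) ×
        (∃ λ ℓ → ScaledBy p ℓ (+ n - + m) (+ m - + 1)))
      ⇔ (∃ λ h → h ≥ 1 × m ≡ p ^ h × n ≡ m Data.Nat.* m))
    × ((m n : ℤ) →
      (PlusMinusPow p m × PlusMinusPow p n ×
        (∃ λ ℓ → ScaledBy p ℓ (n - m) (m - + 1) ⊎ ScaledBy p ℓ (n - m) (- (m - + 1))))
      ⇔ (PlusMinusPow p m × PlusMinusPow p n ×
          (n ≡ m * m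
          ⊎ (p ≡ 2 × ((m ≡ - (+ 2) × n ≡ - (+ 8)) ⊎ (m ≡ + 2 × n ≡ - (+ 2))
                      ⊎ (m ≡ + 4 × n ≡ - (+ 2)) ⊎ (m ≡ + 4 × n ≡ - (+ 8))))
          ⊎ (p ≡ 3 × m ≡ + 3 × n ≡ - (+ 3)))))
lemma4p4 p p-prime = part1 p 1<p , part2 p 1<p
  where
  1<p : 1 < p
  1<p = ℕ.nonTrivial⇒n>1 p {{prime⇒nonTrivial p-prime}}
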